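{- Let $\mathbf a,\mathbf b\in\{0,1\}^\infty$. Let $\Sigma_{\mathbf a,\mathbf b}=\{i_1i_2\cdots\in\{0,1\}^\infty:\mathbf a\le i_ni_{n+1}\cdots\le\mathbf b\text{ for all }n\ge1\}$ and $\Omega_{0\mathbf b,1\mathbf a}=\{i_1i_2\cdots\in\{0,1\}^\infty : i_ni_{n+1}\cdots\le0\mathbf b\text{ or } i_ni_{n+1}\cdots\ge1\mathbf a\text{ for all }n\ge1\}$. Then $\Omega_{0\mathbf b,1\mathbf a}=0^*\Sigma_{\mathbf a,\mathbf b}\cup1^*\Sigma_{\mathbf a,\mathbf b}\cup\{\overline{0},\overline{1}\}$. Hence $\Sigma_{\mathbf a,\mathbf b}=\emptyset$ if and only if $\Omega_{0\mathbf b,1\mathbf a}=\{\overline{0},\overline{1}\}$; $\Sigma_{\mathbf a,\mathbf b}$ is countable if and only if $\Omega_{0\mathbf b,1\mathbf a}$ is countable; and $h(\Sigma_{\mathbf a,\mathbf b})=h(\Omega_{0\mathbf b,1\mathbf a})$.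
   Context: Sequences in $\{0,1\}^\infty$ are ordered lexicographically with $0<1$. $\overline{c}$ is the infinite repetition of $c$; $c^*=\{c^k:k\ge0\}$ for a letter $c$, and $c^*X=\{c^k\mathbf x:k\ge0,\mathbf x\in X\}$. Entropy of a shift-invariant $X\subseteq\{0,1\}^\infty$: $h(X)=\lim_n\frac1n\log A_n(X)$, with $A_n(X)$ the number of distinct length-$n$ blocks occurring in elements of $X$. -}

module Defs where

open import Data.Nat using (ℕ; zero; suc; _+_; _*_; _∸_; _^_; _≤_; _<_; _⊔_; _<ᵇ_)
open import Data.Bool using (Bool; true; false; if_then_else_)
open import Data.Product using (Σ; ∃; ∃-syntax; _×_; _,_)
open import Data.Sum using (_⊎_)
open import Data.Empty using (⊥)
open import Data.Vec using (Vec; lookup)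
open import Data.Fin using (Fin; toℕ)
open import Data.List using (List; length)
open import Data.List.Relation.Unary.All using (All)
open import Data.List.Relation.Unary.Unique.Propositional using (Unique)
open import Data.List.Membership.Propositional using (_∈_)
open import Relation.Binary.PropositionalEquality using (_≡_)
open import Relation.Nullary using (¬_)

-- Infinite binary sequences {0,1}^∞, with 0 = false, 1 = true, indexed from 0.
Seq : Set
Seq = ℕ → Bool

SeqSet : Set₁
SeqSet = Seq → Set

_≈ₛ_ : Seq → Seq → Set
x ≈ₛ y = ∀ i → x i ≡ y i

_<ₗ_ : Seq → Seq → Set
x <ₗ y = ∃[ k ] ((∀ i → i < k → x i ≡ y i) × (x k ≡ false) × (y k ≡ true))

_≤ₗ_ : Seq → Seq → Set
x ≤ₗ y = (x <ₗ y) ⊎ (x ≈ₛ y)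

-- The tail i_{n+1} i_{n+2} ... (shift by n; n = 0 gives the sequence itself).
tail : ℕ → Seq → Seq
tail n x i = x (n + i)

cons : Bool → Seq → Seq
cons c x zero    = c
cons c x (suc i) = x i

prefixRep : Bool → ℕ → Seq → Seq
prefixRep c k x i = if i <ᵇ k then c else x (i ∸ k)

constSeq : Bool → Seq
constSeq c _ = c

SigmaAB : Seq → Seq → SeqSet
SigmaAB a b x = ∀ n → (a ≤ₗ tail n x) × (tail n x ≤ₗ b)

Omega : Seq → Seq → SeqSet
Omega a b x = ∀ n → (tail n x ≤ₗ cons false b) ⊎ (cons true a ≤ₗ tail n x)

starPrefix : Bool → SeqSet → SeqSet
starPrefix c X x = Σ ℕ λ k → Σ Seq λ y → (X y × (x ≈ₛ prefixRep c k y))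

constPair : SeqSet
constPair x = (x ≈ₛ constSeq false) ⊎ (x ≈ₛ constSeq true)

_∪_ : SeqSet → SeqSet → SeqSet
(X ∪ Y) x = X x ⊎ Y x

_≐_ : SeqSet → SeqSet → Set
X ≐ Y = (∀ x → X x → Y x) × (∀ x → Y x → X x)

IsEmpty : SeqSet → Set
IsEmpty X = ∀ x → ¬ X x

Countable : SeqSet → Set
Countable X = IsEmpty X ⊎ (Σ (ℕ → Seq) λ f → (∀ x → X x → Σ ℕ λ n → (f n ≈ₛ x)))

Occurs : SeqSet → (n : ℕ) → Vec Bool n → Set
Occurs X n w = Σ Seq λ x → (X x × Σ ℕ λ j → (∀ (i : Fin n) → x (j + toℕ i) ≡ lookup w i))

BlockCount : SeqSet → ℕ → ℕ → Set
BlockCount X n k = Σ (List (Vec Bool n)) λ ws → ((length ws ≡ k) × Unique ws × All (Occurs X n) ws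
                            × (∀ w → Occurs X n w → w ∈ ws))

-- h(X) = h(Y), with h(X) = lim (1/n) log A_n(X) (limits exist for shift-invariant
-- X by Fekete), expressed without reals as
--   (1/n) log A_n(X) - (1/n) log A_n(Y) → 0,
-- i.e. for every m ≥ 1 eventually |log₂ A_n(X) - log₂ A_n(Y)| ≤ n/m, i.e.
--   A_n(X)^m ≤ 2^n A_n(Y)^m  and  A_n(Y)^m ≤ 2^n A_n(X)^m.
-- Convention: log 0 read as log 1 (A_n replaced by max(A_n,1)), so h(∅) = 0.
SameEntropy : SeqSet → SeqSet → Set
SameEntropy X Y = ∀ m → ∃[ N ] ∀ n → N ≤ n → ∀ p q → BlockCount X n p → BlockCount Y n q →
  ((p ⊔ 1) ^ suc m ≤ 2 ^ n * (q ⊔ 1) ^ suc m) × ((q ⊔ 1) ^ suc m ≤ 2 ^ n * (p ⊔ 1) ^ suc m)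

-- Write Gap z for "z ≤ 0b or 1a ≤ z", so that x ∈ Ω exactly when every tail of x satisfies Gap.
-- For z = c z′, Gap z says z′ ≤ b if c = 0 and a ≤ z′ if c = 1. Since 0z ≤ z ≤ 1z, inside Ω a
-- lower bound a ≤ z passes on to all later tails, and so does an upper bound z ≤ b. Hence once
-- x ∈ Ω switches letters, the tail after the first switch lies in Σ and x is c^k followed by that
-- tail; by excluded middle, a sequence that never switches is constant. Conversely Σ ⊆ Ω, and
-- prepending 0s to an element of Ω below b (or 1s to one above a) stays in Ω. Emptiness and
-- countability transfer along this decomposition. For the entropy, every length-n block of Ω is
-- c^r followed by the beginning of a Σ-block, with r ≤ n, so A_n(Σ) ≤ A_n(Ω) ≤ 2(n+1)(A_n(Σ)+1):
-- a polynomial factor, invisible at exponential scale.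
{-# OPTIONS --safe #-}
module Submission where

open import Defs
open import Level using (0ℓ)
open import Axiom.ExcludedMiddle using (ExcludedMiddle)
open import Data.Bool using (Bool; true; false; not; if_then_else_)
open import Data.Bool.Properties using (not-¬; ¬-not) renaming (_≟_ to _≟ᵇ_)
open import Data.Empty using (⊥-elim)
open import Data.Fin using (toℕ)
open import Data.Fin.Properties using (toℕ<n)
open import Data.List using (List; []; _∷_; length; map; upTo; cartesianProduct; cartesianProductWith)
open import Data.List.Properties using (length-++; length-map; length-upTo; length-removeAt′)
open import Data.List.Membership.Propositional using (_∈_; _─_)
open import Data.List.Membership.Propositional.Properties
  using (∈-upTo⁺; ∈-cartesianProductWith⁺; ∈-cartesianProduct⁺)
open import Data.List.Relation.Binary.Subset.Propositional using (_⊆_)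
open import Data.List.Relation.Unary.All as All using ()
open import Data.List.Relation.Unary.AllPairs using (_∷_)
open import Data.List.Relation.Unary.Any using (here; there; index)
open import Data.List.Relation.Unary.Unique.Propositional using (Unique)
open import Data.Nat
open import Data.Nat.DivMod using (_/_; _%_; m≡m%n+[m/n]*n; m%n<n; m*n/n≡m; m/n*n≤m; /-monoˡ-≤)
open import Data.Nat.Properties
open import Algebra.Properties.CommutativeSemigroup *-commutativeSemigroup
  using () renaming (interchange to *-interchange)
open import Data.Nat.Tactic.RingSolver using (solve-∀)
open import Data.Product using (∃; ∃₂; ∃-syntax; _×_; _,_; proj₁; proj₂; uncurry)
open import Data.Sum using (_⊎_; inj₁; inj₂) renaming (map to ⊎-map)
open import Data.Vec using (Vec; []; _∷_; tabulate)
open import Data.Vec.Properties using (tabulate-cong; tabulate∘lookup; lookup∘tabulate)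
open import Function using (_∘_)
open import Function.Bundles using (_⇔_; mk⇔)
open import Relation.Binary.Definitions using (tri<; tri≈; tri>)
open import Relation.Binary.PropositionalEquality
open import Relation.Nullary using (¬_; yes; no)
open import Relation.Nullary.Decidable using (decidable-stable)

private variable
  x y z : Seq
  c : Bool
  X Y : SeqSet

-- Lexicographic order

≈ₛ-refl : x ≈ₛ x
≈ₛ-refl _ = refl

≈ₛ-sym : x ≈ₛ y → y ≈ₛ x
≈ₛ-sym x≈y i = sym (x≈y i)

≈ₛ-trans : x ≈ₛ y → y ≈ₛ z → x ≈ₛ z
≈ₛ-trans x≈y y≈z i = trans (x≈y i) (y≈z i)

<ₗ-resp-≈ₛ : ∀ {x′ y′} → x ≈ₛ x′ → y ≈ₛ y′ → x <ₗ y → x′ <ₗ y′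
<ₗ-resp-≈ₛ ex ey (k , agree , xk , yk) =
  k , (λ i i<k → trans (sym (ex i)) (trans (agree i i<k) (ey i))) , trans (sym (ex k)) xk , trans (sym (ey k)) yk

≤ₗ-resp-≈ₛ : ∀ {x′ y′} → x ≈ₛ x′ → y ≈ₛ y′ → x ≤ₗ y → x′ ≤ₗ y′
≤ₗ-resp-≈ₛ ex ey (inj₁ x<y) = inj₁ (<ₗ-resp-≈ₛ ex ey x<y)
≤ₗ-resp-≈ₛ ex ey (inj₂ x≈y) = inj₂ (≈ₛ-trans (≈ₛ-sym ex) (≈ₛ-trans x≈y ey))

<ₗ-trans : x <ₗ y → y <ₗ z → x <ₗ z
<ₗ-trans (k , agree , xk , yk) (l , agree′ , yl , zl) with <-cmp k l
... | tri< k<l _ _  =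
  k , (λ i i<k → trans (agree i i<k) (agree′ i (<-trans i<k k<l))) , xk , trans (sym (agree′ k k<l)) yk
... | tri≈ _ refl _ = ⊥-elim (not-¬ yk yl)
... | tri> _ _ l<k  =
  l , (λ i i<l → trans (agree i (<-trans i<l l<k)) (agree′ i i<l)) , trans (agree l l<k) yl , zl

≤ₗ-trans : x ≤ₗ y → y ≤ₗ z → x ≤ₗ z
≤ₗ-trans (inj₁ x<y) (inj₁ y<z) = inj₁ (<ₗ-trans x<y y<z)
≤ₗ-trans (inj₁ x<y) (inj₂ y≈z) = inj₁ (<ₗ-resp-≈ₛ ≈ₛ-refl y≈z x<y)
≤ₗ-trans (inj₂ x≈y) (inj₁ y<z) = inj₁ (<ₗ-resp-≈ₛ (≈ₛ-sym x≈y) ≈ₛ-refl y<z)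
≤ₗ-trans (inj₂ x≈y) (inj₂ y≈z) = inj₂ (≈ₛ-trans x≈y y≈z)

tail-<ₗ⇒<ₗ : x 0 ≡ y 0 → tail 1 x <ₗ tail 1 y → x <ₗ y
tail-<ₗ⇒<ₗ {x} {y} x0≡y0 (k , agree , xk , yk) = suc k , agree′ , xk , yk
  where
  agree′ : ∀ i → i < suc k → x i ≡ y i
  agree′ zero    _         = x0≡y0
  agree′ (suc i) (s≤s i<k) = agree i i<k

tail-≤ₗ⇒≤ₗ : x 0 ≡ y 0 → tail 1 x ≤ₗ tail 1 y → x ≤ₗ y
tail-≤ₗ⇒≤ₗ x0≡y0 (inj₁ x<y) = inj₁ (tail-<ₗ⇒<ₗ x0≡y0 x<y)
tail-≤ₗ⇒≤ₗ x0≡y0 (inj₂ x≈y) = inj₂ λ { zero → x0≡y0 ; (suc i) → x≈y i }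

≤ₗ⇒tail-≤ₗ : x 0 ≡ y 0 → x ≤ₗ y → tail 1 x ≤ₗ tail 1 y
≤ₗ⇒tail-≤ₗ x0≡y0 (inj₁ (zero , _ , x0 , y0))    = ⊥-elim (not-¬ x0 (trans x0≡y0 y0))
≤ₗ⇒tail-≤ₗ _     (inj₁ (suc k , agree , xk , yk)) = inj₁ (k , (λ i i<k → agree (suc i) (s≤s i<k)) , xk , yk)
≤ₗ⇒tail-≤ₗ _     (inj₂ x≈y)                   = inj₂ (λ i → x≈y (suc i))

≤ₗ⇒head-true : x ≤ₗ y → x 0 ≡ true → y 0 ≡ true
≤ₗ⇒head-true (inj₁ (zero , _ , x0 , _))     x0≡true = ⊥-elim (not-¬ x0 x0≡true)
≤ₗ⇒head-true (inj₁ (suc k , agree , _ , _)) x0≡true = trans (sym (agree 0 z<s)) x0≡true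
≤ₗ⇒head-true (inj₂ x≈y)                     x0≡true = trans (sym (x≈y 0)) x0≡true

LexStep : (Seq → Seq → Set) → Seq → Seq → Set
LexStep R x y = (x 0 ≡ false × y 0 ≡ true) ⊎ (x 0 ≡ y 0 × R (tail 1 x) (tail 1 y))

-- Prefixes c^k

prefixRep-< : ∀ {i k} → i < k → prefixRep c k y i ≡ c
prefixRep-< {i = zero}          {suc k} _         = refl
prefixRep-< {c = c} {y} {suc i} {suc k} (s<s i<k) = prefixRep-< {c = c} {y} {i} i<k

prefixRep-≥ : ∀ {i k} → k ≤ i → prefixRep c k y i ≡ y (i ∸ k)
prefixRep-≥ {k = zero}                  _         = refl
prefixRep-≥ {c = c} {y} {suc i} {suc k} (s≤s k≤i) = prefixRep-≥ {c = c} {y} {i} k≤i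

prefixRep-cong : ∀ k → y ≈ₛ z → prefixRep c k y ≈ₛ prefixRep c k z
prefixRep-cong {c = c} k y≈z i = cong (λ u → if i <ᵇ k then c else u) (y≈z (i ∸ k))

tail-prefixRep : ∀ j k → tail j (prefixRep c k y) ≈ₛ prefixRep c (k ∸ j) (tail (j ∸ k) y)
tail-prefixRep             zero    zero    _ = refl
tail-prefixRep             zero    (suc k) _ = refl
tail-prefixRep             (suc j) zero    _ = refl
tail-prefixRep {c = c} {y} (suc j) (suc k)   = tail-prefixRep {c = c} {y} j k

starPrefix-step : z 0 ≡ c → starPrefix c X (tail 1 z) → starPrefix c X z
starPrefix-step z0≡c (k , y , Xy , e) = suc k , y , Xy , λ { zero → z0≡c ; (suc i) → e i }

constSeq-constPair : ∀ c → x ≈ₛ constSeq c → constPair x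
constSeq-constPair false = inj₁
constSeq-constPair true  = inj₂

constPair-cons : constPair (cons c y) → y 0 ≡ c
constPair-cons (inj₁ e) = trans (e 1) (sym (e 0))
constPair-cons (inj₂ e) = trans (e 1) (sym (e 0))

Prefixed : SeqSet → SeqSet
Prefixed X = (starPrefix false X ∪ starPrefix true X) ∪ constPair

starPrefix⊆Prefixed : ∀ c → starPrefix c X x → Prefixed X x
starPrefix⊆Prefixed false = inj₁ ∘ inj₁
starPrefix⊆Prefixed true  = inj₁ ∘ inj₂

-- Countability

Enumerates : (ℕ → Seq) → SeqSet → Set
Enumerates f X = ∀ x → X x → ∃ λ n → f n ≈ₛ x

-- Cantor's enumeration of ℕ × ℕ: each anti-diagonal is walked from (s , 0) down to (0 , s).
nextPair : ℕ × ℕ → ℕ × ℕ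
nextPair (zero  , j) = suc j , 0
nextPair (suc i , j) = i , suc j

unpair : ℕ → ℕ × ℕ
unpair zero    = 0 , 0
unpair (suc n) = nextPair (unpair n)

unpair-along-diagonal : ∀ j i → (∃ λ n → unpair n ≡ (i + j , 0)) → ∃ λ n → unpair n ≡ (i , j)
unpair-along-diagonal zero    i (n , e) = n , trans e (cong (_, 0) (+-identityʳ i))
unpair-along-diagonal (suc j) i (n , e)
  with m , e′ ← unpair-along-diagonal j (suc i) (n , trans e (cong (_, 0) (+-suc i j)))
  = suc m , cong nextPair e′

unpair-diagonal-start : ∀ s → ∃ λ n → unpair n ≡ (s , 0)
unpair-diagonal-start zero = 0 , refl
unpair-diagonal-start (suc s)
  with m , e ← unpair-along-diagonal s 0 (unpair-diagonal-start s)
  = suc m , cong nextPair e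

unpair-surjective : ∀ i j → ∃ λ n → unpair n ≡ (i , j)
unpair-surjective i j = unpair-along-diagonal j i (unpair-diagonal-start (i + j))

enumerate-by-pairs : (h : ℕ → ℕ → Seq) → (∀ x → X x → ∃₂ λ i j → h i j ≈ₛ x) →
                     Enumerates (uncurry h ∘ unpair) X
enumerate-by-pairs h cover x Xx
  with i , j , hij≈x ← cover x Xx
  with n , e ← unpair-surjective i j
  = n , subst (λ p → uncurry h p ≈ₛ x) (sym e) hij≈x

Countable-⊆ : (∀ x → X x → Y x) → Countable Y → Countable X
Countable-⊆ X⊆Y (inj₁ emptyY)     = inj₁ λ x Xx → emptyY x (X⊆Y x Xx)
Countable-⊆ X⊆Y (inj₂ (f , enum)) = inj₂ (f , λ x Xx → enum x (X⊆Y x Xx))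

Countable-∪ : Countable X → Countable Y → Countable (X ∪ Y)
Countable-∪ (inj₁ emptyX) cY = Countable-⊆ (λ { x (inj₁ Xx) → ⊥-elim (emptyX x Xx) ; x (inj₂ Yx) → Yx }) cY
Countable-∪ cX (inj₁ emptyY) = Countable-⊆ (λ { x (inj₁ Xx) → Xx ; x (inj₂ Yx) → ⊥-elim (emptyY x Yx) }) cX
Countable-∪ {X} {Y} (inj₂ (f , enumX)) (inj₂ (g , enumY)) = inj₂ (_ , enumerate-by-pairs choose cover)
  where
  choose : ℕ → ℕ → Seq
  choose zero    = f
  choose (suc _) = g
  cover : ∀ x → (X ∪ Y) x → ∃₂ λ i j → choose i j ≈ₛ x
  cover x (inj₁ Xx) = 0 , enumX x Xx
  cover x (inj₂ Yx) = 1 , enumY x Yx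

Countable-starPrefix : ∀ c → Countable X → Countable (starPrefix c X)
Countable-starPrefix c (inj₁ emptyX) = inj₁ λ { x (_ , y , Xy , _) → emptyX y Xy }
Countable-starPrefix {X} c (inj₂ (f , enum)) = inj₂ (_ , enumerate-by-pairs (λ k j → prefixRep c k (f j)) cover)
  where
  cover : ∀ x → starPrefix c X x → ∃₂ λ k j → prefixRep c k (f j) ≈ₛ x
  cover x (k , y , Xy , x≈) with j , fj≈y ← enum y Xy =
    k , j , ≈ₛ-trans (prefixRep-cong k fj≈y) (≈ₛ-sym x≈)

Countable-constPair : Countable constPair
Countable-constPair = inj₂ (constants , λ { x (inj₁ e) → 0 , ≈ₛ-sym e ; x (inj₂ e) → 1 , ≈ₛ-sym e })
  where
  constants : ℕ → Seq
  constants zero    = constSeq false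
  constants (suc _) = constSeq true

Countable-Prefixed : Countable X → Countable (Prefixed X)
Countable-Prefixed cX =
  Countable-∪ (Countable-∪ (Countable-starPrefix false cX) (Countable-starPrefix true cX)) Countable-constPair

Countable-retract : (g h : Seq → Seq) → (∀ {x y} → x ≈ₛ y → h x ≈ₛ h y) →
                    (∀ y → Y y → X (g y)) → (∀ y → h (g y) ≈ₛ y) → Countable X → Countable Y
Countable-retract g h h-cong gY hg (inj₁ emptyX) = inj₁ λ y Yy → emptyX (g y) (gY y Yy)
Countable-retract {Y = Y} g h h-cong gY hg (inj₂ (f , enum)) = inj₂ (h ∘ f , cover)
  where
  cover : ∀ y → Y y → ∃ λ n → h (f n) ≈ₛ y
  cover y Yy with n , fn≈gy ← enum (g y) (gY y Yy) = n , ≈ₛ-trans (h-cong fn≈gy) (hg y)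

-- Counting blocks

∈-─ : ∀ {A : Set} {v w : A} {ys} (v∈ys : v ∈ ys) → w ∈ ys → w ≢ v → w ∈ ys ─ v∈ys
∈-─ (here refl)  (here refl)  w≢v = ⊥-elim (w≢v refl)
∈-─ (here _)     (there w∈ys) _   = w∈ys
∈-─ (there _)    (here refl)  _   = here refl
∈-─ (there v∈ys) (there w∈ys) w≢v = there (∈-─ v∈ys w∈ys w≢v)

Unique⇒length-≤ : ∀ {A : Set} {xs ys : List A} → Unique xs → xs ⊆ ys → length xs ≤ length ys
Unique⇒length-≤ {xs = []}          _                _     = z≤n
Unique⇒length-≤ {xs = x ∷ xs} {ys} (x∉xs ∷ unique) xs⊆ys = begin
  suc (length xs)          ≤⟨ s≤s (Unique⇒length-≤ unique xs⊆ys─x) ⟩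
  suc (length (ys ─ x∈ys)) ≡⟨ length-removeAt′ ys (index x∈ys) ⟨
  length ys                ∎
  where
  open ≤-Reasoning
  x∈ys = xs⊆ys (here refl)
  xs⊆ys─x : xs ⊆ ys ─ x∈ys
  xs⊆ys─x w∈xs = ∈-─ x∈ys (xs⊆ys (there w∈xs)) (λ w≡x → All.lookup x∉xs w∈xs (sym w≡x))

length-cartesianProductWith : ∀ {A B C : Set} (f : A → B → C) xs ys →
                              length (cartesianProductWith f xs ys) ≡ length xs * length ys
length-cartesianProductWith f []       ys = refl
length-cartesianProductWith f (x ∷ xs) ys =
  trans (length-++ (map (f x) ys)) (cong₂ _+_ (length-map (f x) ys) (length-cartesianProductWith f xs ys))

block : (n : ℕ) → Seq → Vec Bool n
block n z = tabulate (z ∘ toℕ)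

block-cong : ∀ n → x ≈ₛ y → block n x ≡ block n y
block-cong n x≈y = tabulate-cong (x≈y ∘ toℕ)

Occurs⇒block : ∀ {n w} → Occurs X n w → ∃ λ x → X x × ∃ λ j → w ≡ block n (tail j x)
Occurs⇒block {w = w} (x , Xx , j , x≡w) = x , Xx , j , trans (sym (tabulate∘lookup w)) (tabulate-cong (sym ∘ x≡w))

block-Occurs : ∀ n j → X x → Occurs X n (block n (tail j x))
block-Occurs n j Xx = _ , Xx , j , λ i → sym (lookup∘tabulate _ i)

extend : ∀ {n} → Vec Bool n → Seq
extend []       _       = false
extend (v ∷ _)  zero    = v
extend (_ ∷ vs) (suc i) = extend vs i

extend-block : ∀ n {i} → i < n → extend (block n z) i ≡ z i
extend-block     (suc n) {zero}  _         = refl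
extend-block {z} (suc n) {suc i} (s<s i<n) = extend-block {tail 1 z} n i<n

padded : ∀ n → Bool → ℕ → Vec Bool n → Vec Bool n
padded n c r v = block n (prefixRep c r (extend v))

block-prefixRep : ∀ n c r y → block n (prefixRep c r y) ≡ padded n c (r ⊓ n) (block n y)
block-prefixRep n c r y = tabulate-cong λ i → agree (toℕ<n i)
  where
  agree : ∀ {m} → m < n → prefixRep c r y m ≡ prefixRep c (r ⊓ n) (extend (block n y)) m
  agree {m} m<n with m <? r
  ... | yes m<r = trans (prefixRep-< {y = y} m<r) (sym (prefixRep-< {y = extend (block n y)} (⊓-pres-m< m<r m<n)))
  ... | no  m≮r rewrite m≤n⇒m⊓n≡m (≤-trans (≮⇒≥ m≮r) (<⇒≤ m<n)) =
    trans (prefixRep-≥ {y = y} (≮⇒≥ m≮r))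
          (sym (trans (prefixRep-≥ {y = extend (block n y)} (≮⇒≥ m≮r))
                      (extend-block {y} n (≤-<-trans (m∸n≤m m r) m<n))))

candidates : ∀ n → List (Vec Bool n) → List (Vec Bool n)
candidates n vs = cartesianProductWith (uncurry ∘ padded n) (false ∷ true ∷ []) (cartesianProduct (upTo (suc n)) vs)

length-candidates : ∀ n vs → length (candidates n vs) ≡ 2 * (suc n * length vs)
length-candidates n vs = begin
  length (candidates n vs)
    ≡⟨ length-cartesianProductWith (uncurry ∘ padded n) (false ∷ true ∷ []) pairs ⟩
  2 * length pairs
    ≡⟨ cong (2 *_) (length-cartesianProductWith _,_ (upTo (suc n)) vs) ⟩
  2 * (length (upTo (suc n)) * length vs)
    ≡⟨ cong (λ k → 2 * (k * length vs)) (length-upTo (suc n)) ⟩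
  2 * (suc n * length vs)
    ∎
  where
  open ≡-Reasoning
  pairs = cartesianProduct (upTo (suc n)) vs

prefixRep-block∈candidates : ∀ {n vs} c r → block n z ∈ vs → block n (prefixRep c r z) ∈ candidates n vs
prefixRep-block∈candidates {z} {n} c r z∈vs =
  subst (_∈ _) (sym (block-prefixRep n c r z))
    (∈-cartesianProductWith⁺ (uncurry ∘ padded n) (bool∈ c)
      (∈-cartesianProduct⁺ (∈-upTo⁺ (s≤s (m⊓n≤n r n))) z∈vs))
  where
  bool∈ : ∀ c → c ∈ false ∷ true ∷ []
  bool∈ false = here refl
  bool∈ true  = there (here refl)

module _ {X : SeqSet} {n : ℕ} {ps : List (Vec Bool n)} (complete : ∀ w → Occurs X n w → w ∈ ps) where

  starPrefix-block∈candidates : ∀ c → starPrefix c X x → ∀ j →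
                                block n (tail j x) ∈ candidates n (block n (constSeq false) ∷ ps)
  starPrefix-block∈candidates c (k , y , Xy , x≈) j =
    subst (_∈ _) (block-cong n (≈ₛ-sym (≈ₛ-trans (λ i → x≈ (j + i)) (tail-prefixRep {y = y} j k))))
      (prefixRep-block∈candidates {tail (j ∸ k) y} c (k ∸ j) (there (complete _ (block-Occurs n (j ∸ k) Xy))))

  -- c^n = padded n c n v for every v, so the vector in front of ps accounts for the constant blocks.
  constant-block∈candidates : ∀ c → x ≈ₛ constSeq c → ∀ j →
                              block n (tail j x) ∈ candidates n (block n (constSeq false) ∷ ps)
  constant-block∈candidates c x≈c j =
    subst (_∈ _) (tabulate-cong λ i → trans (prefixRep-< {y = constSeq false} (toℕ<n i)) (sym (x≈c (j + toℕ i))))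
      (prefixRep-block∈candidates {constSeq false} c n (here refl))

  Prefixed-block∈candidates : Prefixed X x → ∀ j →
                              block n (tail j x) ∈ candidates n (block n (constSeq false) ∷ ps)
  Prefixed-block∈candidates (inj₁ (inj₁ p)) = starPrefix-block∈candidates false p
  Prefixed-block∈candidates (inj₁ (inj₂ p)) = starPrefix-block∈candidates true p
  Prefixed-block∈candidates (inj₂ (inj₁ e)) = constant-block∈candidates false e
  Prefixed-block∈candidates (inj₂ (inj₂ e)) = constant-block∈candidates true e

-- Entropy

^-distribʳ-* : ∀ m n o → (m * n) ^ o ≡ m ^ o * n ^ o
^-distribʳ-* m n zero    = refl
^-distribʳ-* m n (suc o) = trans (cong (m * n *_) (^-distribʳ-* m n o)) (*-interchange m n (m ^ o) (n ^ o))

[1+t]*[1+t]≤2^t : ∀ t → 6 ≤ t → suc t * suc t ≤ 2 ^ t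
[1+t]*[1+t]≤2^t t 6≤t with s , refl ← m≤n⇒∃[o]m+o≡n 6≤t = from-offset s
  where
  from-offset : ∀ s → (7 + s) * (7 + s) ≤ 2 ^ (6 + s)
  from-offset zero    = ≤ᵇ⇒≤ 49 64 _
  from-offset (suc s) = begin
    (8 + s) * (8 + s)                         ≤⟨ m≤m+n _ (34 + 12 * s + s * s) ⟩
    (8 + s) * (8 + s) + (34 + 12 * s + s * s) ≡⟨ expand s ⟩
    2 * ((7 + s) * (7 + s))                   ≤⟨ *-monoʳ-≤ 2 (from-offset s) ⟩
    2 * 2 ^ (6 + s)                           ∎
    where
    open ≤-Reasoning
    expand : ∀ s → (8 + s) * (8 + s) + (34 + 12 * s + s * s) ≡ 2 * ((7 + s) * (7 + s))
    expand = solve-∀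

-- With d = 1 + m and t = n / d ≥ 4d + 6: 4(n + 1) ≤ 4d(t + 1) ≤ (t + 1)² ≤ 2^t, so (4(n + 1))^d ≤ 2^n.
4[1+n]^[1+m]≤2^n-eventually : ∀ m → ∃[ N ] ∀ n → N ≤ n → (4 * suc n) ^ suc m ≤ 2 ^ n
4[1+n]^[1+m]≤2^n-eventually m = d * (4 * d + 6) , bound
  where
  d = suc m
  bound : ∀ n → d * (4 * d + 6) ≤ n → (4 * suc n) ^ d ≤ 2 ^ n
  bound n N≤n = begin
    (4 * suc n) ^ d ≤⟨ ^-monoˡ-≤ d 4[1+n]≤2^t ⟩
    (2 ^ t) ^ d     ≡⟨ ^-*-assoc 2 t d ⟩
    2 ^ (t * d)     ≤⟨ ^-monoʳ-≤ 2 (m/n*n≤m n d) ⟩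
    2 ^ n           ∎
    where
    open ≤-Reasoning
    t = n / d
    4d+6≤t : 4 * d + 6 ≤ t
    4d+6≤t = begin
      4 * d + 6           ≡⟨ m*n/n≡m (4 * d + 6) d ⟨
      (4 * d + 6) * d / d ≤⟨ /-monoˡ-≤ d (≤-trans (≤-reflexive (*-comm (4 * d + 6) d)) N≤n) ⟩
      t                   ∎
    1+n≤d[1+t] : suc n ≤ d * suc t
    1+n≤d[1+t] = begin
      suc n               ≡⟨ cong suc (m≡m%n+[m/n]*n n d) ⟩
      suc (n % d + t * d) ≤⟨ +-monoˡ-≤ (t * d) (m%n<n n d) ⟩
      d + t * d           ≡⟨ cong (d +_) (*-comm t d) ⟩
      d + d * t           ≡⟨ *-suc d t ⟨
      d * suc t           ∎
    4[1+n]≤2^t : 4 * suc n ≤ 2 ^ t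
    4[1+n]≤2^t = begin
      4 * suc n       ≤⟨ *-monoʳ-≤ 4 1+n≤d[1+t] ⟩
      4 * (d * suc t) ≡⟨ *-assoc 4 d (suc t) ⟨
      4 * d * suc t   ≤⟨ *-monoˡ-≤ (suc t) (≤-trans (m≤m+n (4 * d) 6) (≤-trans 4d+6≤t (n≤1+n t))) ⟩
      suc t * suc t   ≤⟨ [1+t]*[1+t]≤2^t t (≤-trans (m≤n+m 6 (4 * d)) 4d+6≤t) ⟩
      2 ^ t           ∎

SameEntropy-intro : (∀ n p q → BlockCount X n p → BlockCount Y n q → p ≤ q × q ≤ 2 * (suc n * suc p)) →
                    SameEntropy X Y
SameEntropy-intro close m with N , poly≤exp ← 4[1+n]^[1+m]≤2^n-eventually m =
  N , λ n N≤n p q Xp Yq → let p≤q , q≤ = close n p q Xp Yq in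
    ≤-trans (^-monoˡ-≤ d (⊔-monoˡ-≤ 1 p≤q)) (m≤n*m _ (2 ^ n) {{m^n≢0 2 n}}) ,
    (begin
      (q ⊔ 1) ^ d                   ≤⟨ ^-monoˡ-≤ d (q⊔1≤4[1+n][p⊔1] n p q q≤) ⟩
      (4 * suc n * (p ⊔ 1)) ^ d     ≡⟨ ^-distribʳ-* (4 * suc n) (p ⊔ 1) d ⟩
      (4 * suc n) ^ d * (p ⊔ 1) ^ d ≤⟨ *-monoˡ-≤ ((p ⊔ 1) ^ d) (poly≤exp n N≤n) ⟩
      2 ^ n * (p ⊔ 1) ^ d           ∎)
  where
  open ≤-Reasoning
  d = suc m
  q⊔1≤4[1+n][p⊔1] : ∀ n p q → q ≤ 2 * (suc n * suc p) → q ⊔ 1 ≤ 4 * suc n * (p ⊔ 1)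
  q⊔1≤4[1+n][p⊔1] n p q q≤ = begin
    q ⊔ 1                             ≤⟨ ⊔-lub q≤ (s≤s z≤n) ⟩
    2 * (suc n * suc p)               ≤⟨ *-monoʳ-≤ 2 (*-monoʳ-≤ (suc n) 1+p≤) ⟩
    2 * (suc n * ((p ⊔ 1) + (p ⊔ 1))) ≡⟨ rearrange (suc n) (p ⊔ 1) ⟩
    4 * suc n * (p ⊔ 1)               ∎
    where
    1+p≤ : suc p ≤ (p ⊔ 1) + (p ⊔ 1)
    1+p≤ = ≤-trans (≤-reflexive (+-comm 1 p)) (+-mono-≤ (m≤m⊔n p 1) (m≤n⊔m p 1))
    rearrange : ∀ k x → 2 * (k * (x + x)) ≡ 4 * k * x
    rearrange = solve-∀

-- Σ_{a,b} and Ω_{0b,1a}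

module _ (lem : ExcludedMiddle 0ℓ) where

  no-difference⇒≈ₛ : ¬ (∃ λ i → x i ≢ y i) → x ≈ₛ y
  no-difference⇒≈ₛ {x} {y} ¬differ i = decidable-stable (x i ≟ᵇ y i) (λ xi≢yi → ¬differ (i , xi≢yi))

  ≤ₗ-coinduction : (R : Seq → Seq → Set) → (∀ x y → R x y → LexStep R x y) → R x y → x ≤ₗ y
  ≤ₗ-coinduction {x} {y} R step r with lem {∃ λ i → x i ≢ y i}
  ... | no  ¬differ     = inj₂ (no-difference⇒≈ₛ ¬differ)
  ... | yes (i , xi≢yi) = inj₁ (differ i r xi≢yi)
    where
    differ : ∀ i {x y} → R x y → x i ≢ y i → x <ₗ y
    differ i r xi≢yi with step _ _ r
    ... | inj₁ (x0 , y0) = 0 , (λ _ ()) , x0 , y0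
    differ zero    r xi≢yi | inj₂ (x0≡y0 , _)  = ⊥-elim (xi≢yi x0≡y0)
    differ (suc i) r xi≢yi | inj₂ (x0≡y0 , r′) = tail-<ₗ⇒<ₗ x0≡y0 (differ i r′ xi≢yi)

  constSeq-false-≤ₗ : constSeq false ≤ₗ y
  constSeq-false-≤ₗ = ≤ₗ-coinduction R step ≈ₛ-refl
    where
    R : Seq → Seq → Set
    R x _ = x ≈ₛ constSeq false
    step : ∀ x y → R x y → LexStep R x y
    step x y x≈0 with y 0
    ... | false = inj₂ (x≈0 0 , λ i → x≈0 (suc i))
    ... | true  = inj₁ (x≈0 0 , refl)

  ≤ₗ-constSeq-true : x ≤ₗ constSeq true
  ≤ₗ-constSeq-true = ≤ₗ-coinduction R step ≈ₛ-refl
    where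
    R : Seq → Seq → Set
    R _ y = y ≈ₛ constSeq true
    step : ∀ x y → R x y → LexStep R x y
    step x y y≈1 with x 0
    ... | false = inj₁ (refl , y≈1 0)
    ... | true  = inj₂ (sym (y≈1 0) , λ i → y≈1 (suc i))

  head-false⇒≤ₗ-tail : z 0 ≡ false → z ≤ₗ tail 1 z
  head-false⇒≤ₗ-tail z0 = ≤ₗ-coinduction R step (z0 , ≈ₛ-refl)
    where
    R : Seq → Seq → Set
    R x y = x 0 ≡ false × tail 1 x ≈ₛ y
    step : ∀ x y → R x y → LexStep R x y
    step x y (x0 , e) with y 0 in y0
    ... | false = inj₂ (x0 , trans (e 0) y0 , λ i → e (suc i))
    ... | true  = inj₁ (x0 , refl)

  head-true⇒tail-≤ₗ : z 0 ≡ true → tail 1 z ≤ₗ z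
  head-true⇒tail-≤ₗ z0 = ≤ₗ-coinduction R step (z0 , ≈ₛ-refl)
    where
    R : Seq → Seq → Set
    R x y = y 0 ≡ true × tail 1 y ≈ₛ x
    step : ∀ x y → R x y → LexStep R x y
    step x y (y0 , e) with x 0 in x0
    ... | false = inj₁ (refl , y0)
    ... | true  = inj₂ (sym y0 , trans (e 0) x0 , λ i → e (suc i))

  module _ (a b : Seq) where

    -- Omega a b x unfolds to ∀ n → Gap (tail n x), and tail n (tail 1 x) to tail (suc n) x.
    Gap : SeqSet
    Gap z = (z ≤ₗ cons false b) ⊎ (cons true a ≤ₗ z)

    gap-false : Gap z → z 0 ≡ false → tail 1 z ≤ₗ b
    gap-false (inj₁ z≤0b) z0 = ≤ₗ⇒tail-≤ₗ z0 z≤0b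
    gap-false (inj₂ 1a≤z) z0 = ⊥-elim (not-¬ z0 (≤ₗ⇒head-true 1a≤z refl))

    gap-true : Gap z → z 0 ≡ true → a ≤ₗ tail 1 z
    gap-true (inj₁ z≤0b) z0 = ⊥-elim (not-¬ (≤ₗ⇒head-true z≤0b z0) refl)
    gap-true (inj₂ 1a≤z) z0 = ≤ₗ⇒tail-≤ₗ (sym z0) 1a≤z

    gap-false-intro : z 0 ≡ false → tail 1 z ≤ₗ b → Gap z
    gap-false-intro z0 tail≤b = inj₁ (tail-≤ₗ⇒≤ₗ z0 tail≤b)

    gap-true-intro : z 0 ≡ true → a ≤ₗ tail 1 z → Gap z
    gap-true-intro z0 a≤tail = inj₂ (tail-≤ₗ⇒≤ₗ (sym z0) a≤tail)

    Omega-resp-≈ₛ : x ≈ₛ y → Omega a b x → Omega a b y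
    Omega-resp-≈ₛ x≈y om n =
      ⊎-map (≤ₗ-resp-≈ₛ (x≈y ∘ (n +_)) ≈ₛ-refl) (≤ₗ-resp-≈ₛ ≈ₛ-refl (x≈y ∘ (n +_))) (om n)

    Omega-head-false⇒≤ₗ : Omega a b z → z 0 ≡ false → z ≤ₗ b
    Omega-head-false⇒≤ₗ om z0 = ≤ₗ-trans (head-false⇒≤ₗ-tail z0) (gap-false (om 0) z0)

    Omega-head-true⇒≥ₗ : Omega a b z → z 0 ≡ true → a ≤ₗ z
    Omega-head-true⇒≥ₗ om z0 = ≤ₗ-trans (gap-true (om 0) z0) (head-true⇒tail-≤ₗ z0)

    Omega-≤ₗ-tail : Omega a b z → z ≤ₗ b → tail 1 z ≤ₗ b
    Omega-≤ₗ-tail {z} om z≤b with z 0 in z0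
    ... | false = gap-false (om 0) z0
    ... | true  = ≤ₗ-trans (head-true⇒tail-≤ₗ z0) z≤b

    Omega-≥ₗ-tail : Omega a b z → a ≤ₗ z → a ≤ₗ tail 1 z
    Omega-≥ₗ-tail {z} om a≤z with z 0 in z0
    ... | false = ≤ₗ-trans a≤z (head-false⇒≤ₗ-tail z0)
    ... | true  = gap-true (om 0) z0

    Omega-bounded⇒Sigma : Omega a b z → a ≤ₗ z → z ≤ₗ b → SigmaAB a b z
    Omega-bounded⇒Sigma     om a≤z z≤b zero    = a≤z , z≤b
    Omega-bounded⇒Sigma {z} om a≤z z≤b (suc n) =
      Omega-bounded⇒Sigma {tail 1 z} (om ∘ suc) (Omega-≥ₗ-tail om a≤z) (Omega-≤ₗ-tail om z≤b) n

    Omega-switch⇒Sigma : Omega a b z → z 0 ≡ c → z 1 ≡ not c → SigmaAB a b (tail 1 z)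
    Omega-switch⇒Sigma {z} {false} om z0 z1 =
      Omega-bounded⇒Sigma {tail 1 z} (om ∘ suc)
        (Omega-head-true⇒≥ₗ {tail 1 z} (om ∘ suc) z1) (gap-false (om 0) z0)
    Omega-switch⇒Sigma {z} {true}  om z0 z1 =
      Omega-bounded⇒Sigma {tail 1 z} (om ∘ suc)
        (gap-true (om 0) z0) (Omega-head-false⇒≤ₗ {tail 1 z} (om ∘ suc) z1)

    Omega⇒starPrefix : ∀ i → Omega a b z → z 0 ≡ c → z i ≡ not c → starPrefix c (SigmaAB a b) z
    Omega⇒starPrefix         zero    om z0 zi = ⊥-elim (not-¬ z0 zi)
    Omega⇒starPrefix {z} {c} (suc i) om z0 zi = starPrefix-step z0 tail∈starPrefix
      where
      tail∈starPrefix : starPrefix c (SigmaAB a b) (tail 1 z)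
      tail∈starPrefix with z 1 ≟ᵇ c
      ... | yes z1≡c = Omega⇒starPrefix {tail 1 z} i (om ∘ suc) z1≡c zi
      ... | no  z1≢c = 0 , tail 1 z , Omega-switch⇒Sigma {z} om z0 (¬-not z1≢c) , ≈ₛ-refl

    Omega⊆Prefixed : ∀ x → Omega a b x → Prefixed (SigmaAB a b) x
    Omega⊆Prefixed x om with lem {∃ λ i → x i ≢ x 0}
    ... | yes (i , xi≢x0) = starPrefix⊆Prefixed (x 0) (Omega⇒starPrefix i om refl (¬-not xi≢x0))
    ... | no  ¬differ     = inj₂ (constSeq-constPair (x 0) (no-difference⇒≈ₛ ¬differ))

    Sigma⊆Omega : ∀ z → SigmaAB a b z → Omega a b z
    Sigma⊆Omega z s zero with z 0 in z0
    ... | false = gap-false-intro z0 (proj₂ (s 1))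
    ... | true  = gap-true-intro z0 (proj₁ (s 1))
    Sigma⊆Omega z s (suc n) = Sigma⊆Omega (tail 1 z) (s ∘ suc) n

    Omega-prepend-false : z 0 ≡ false → Omega a b (tail 1 z) → tail 1 z ≤ₗ b → Omega a b z × z ≤ₗ b
    Omega-prepend-false z0 om tail≤b =
      (λ { zero → gap-false-intro z0 tail≤b ; (suc n) → om n }) , ≤ₗ-trans (head-false⇒≤ₗ-tail z0) tail≤b

    Omega-prepend-true : z 0 ≡ true → Omega a b (tail 1 z) → a ≤ₗ tail 1 z → Omega a b z × a ≤ₗ z
    Omega-prepend-true z0 om a≤tail =
      (λ { zero → gap-true-intro z0 a≤tail ; (suc n) → om n }) , ≤ₗ-trans a≤tail (head-true⇒tail-≤ₗ z0)

    Omega-prefixRep-false : ∀ k → Omega a b y → y ≤ₗ b →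
                            Omega a b (prefixRep false k y) × prefixRep false k y ≤ₗ b
    Omega-prefixRep-false zero    om y≤b = om , y≤b
    Omega-prefixRep-false (suc k) om y≤b = uncurry (Omega-prepend-false refl) (Omega-prefixRep-false k om y≤b)

    Omega-prefixRep-true : ∀ k → Omega a b y → a ≤ₗ y →
                           Omega a b (prefixRep true k y) × a ≤ₗ prefixRep true k y
    Omega-prefixRep-true zero    om a≤y = om , a≤y
    Omega-prefixRep-true (suc k) om a≤y = uncurry (Omega-prepend-true refl) (Omega-prefixRep-true k om a≤y)

    starPrefix⊆Omega : ∀ c → starPrefix c (SigmaAB a b) x → Omega a b x
    starPrefix⊆Omega false (k , y , s , x≈) =
      Omega-resp-≈ₛ (≈ₛ-sym x≈) (proj₁ (Omega-prefixRep-false k (Sigma⊆Omega y s) (proj₂ (s 0))))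
    starPrefix⊆Omega true  (k , y , s , x≈) =
      Omega-resp-≈ₛ (≈ₛ-sym x≈) (proj₁ (Omega-prefixRep-true k (Sigma⊆Omega y s) (proj₁ (s 0))))

    Prefixed⊆Omega : ∀ x → Prefixed (SigmaAB a b) x → Omega a b x
    Prefixed⊆Omega _ (inj₁ (inj₁ p)) = starPrefix⊆Omega false p
    Prefixed⊆Omega _ (inj₁ (inj₂ p)) = starPrefix⊆Omega true p
    Prefixed⊆Omega _ (inj₂ (inj₁ e)) = Omega-resp-≈ₛ (≈ₛ-sym e) (λ _ → inj₁ constSeq-false-≤ₗ)
    Prefixed⊆Omega _ (inj₂ (inj₂ e)) = Omega-resp-≈ₛ (≈ₛ-sym e) (λ _ → inj₂ ≤ₗ-constSeq-true)

    Omega≐Prefixed : Omega a b ≐ Prefixed (SigmaAB a b)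
    Omega≐Prefixed = Omega⊆Prefixed , Prefixed⊆Omega

    Sigma-cons⊆Omega : ∀ c → SigmaAB a b y → Omega a b (cons c y)
    Sigma-cons⊆Omega {y} c s =
      Prefixed⊆Omega (cons c y) (starPrefix⊆Prefixed c (1 , y , s , λ { zero → refl ; (suc i) → refl }))

    Sigma-empty⇔Omega≐constPair : IsEmpty (SigmaAB a b) ⇔ (Omega a b ≐ constPair)
    Sigma-empty⇔Omega≐constPair = mk⇔ to from
      where
      to : IsEmpty (SigmaAB a b) → Omega a b ≐ constPair
      to empty = (λ x → only-constants ∘ Omega⊆Prefixed x) , (λ x → Prefixed⊆Omega x ∘ inj₂)
        where
        only-constants : Prefixed (SigmaAB a b) x → constPair x
        only-constants (inj₁ (inj₁ (_ , y , s , _))) = ⊥-elim (empty y s)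
        only-constants (inj₁ (inj₂ (_ , y , s , _))) = ⊥-elim (empty y s)
        only-constants (inj₂ constant)               = constant
      from : Omega a b ≐ constPair → IsEmpty (SigmaAB a b)
      from (Omega⊆constPair , _) y s =
        not-¬ (constPair-cons (Omega⊆constPair (cons false y) (Sigma-cons⊆Omega false s)))
              (constPair-cons (Omega⊆constPair (cons true y) (Sigma-cons⊆Omega true s)))

    Sigma-countable⇔Omega-countable : Countable (SigmaAB a b) ⇔ Countable (Omega a b)
    Sigma-countable⇔Omega-countable = mk⇔
      (Countable-⊆ Omega⊆Prefixed ∘ Countable-Prefixed)
      (Countable-retract (cons false) (tail 1) (λ x≈y i → x≈y (suc i))
                         (λ _ → Sigma-cons⊆Omega false) (λ _ _ → refl))

    Sigma-Omega-sameEntropy : SameEntropy (SigmaAB a b) (Omega a b)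
    Sigma-Omega-sameEntropy = SameEntropy-intro close
      where
      close : ∀ n p q → BlockCount (SigmaAB a b) n p → BlockCount (Omega a b) n q →
              p ≤ q × q ≤ 2 * (suc n * suc p)
      close n _ _ (ps , refl , uniqueΣ , occursΣ , completeΣ) (qs , refl , uniqueΩ , occursΩ , completeΩ) =
        Unique⇒length-≤ uniqueΣ ps⊆qs ,
        ≤-trans (Unique⇒length-≤ uniqueΩ qs⊆candidates) (≤-reflexive (length-candidates n vs))
        where
        ps⊆qs : ps ⊆ qs
        ps⊆qs w∈ps with x , s , at-j ← All.lookup occursΣ w∈ps = completeΩ _ (x , Sigma⊆Omega x s , at-j)
        vs = block n (constSeq false) ∷ ps
        qs⊆candidates : qs ⊆ candidates n vs
        qs⊆candidates {w} w∈qs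
          with x , om , j , refl ← Occurs⇒block {X = Omega a b} {w = w} (All.lookup occursΩ w∈qs) =
          Prefixed-block∈candidates completeΣ (Omega⊆Prefixed x om) j

theorem5 : ExcludedMiddle 0ℓ → (a b : Seq) →
    (Omega a b ≐ ((starPrefix false (SigmaAB a b) ∪ starPrefix true (SigmaAB a b)) ∪ constPair))
    × (IsEmpty (SigmaAB a b) ⇔ (Omega a b ≐ constPair))
    × (Countable (SigmaAB a b) ⇔ Countable (Omega a b))
    × SameEntropy (SigmaAB a b) (Omega a b)
theorem5 lem a b =
  Omega≐Prefixed lem a b , Sigma-empty⇔Omega≐constPair lem a b ,
  Sigma-countable⇔Omega-countable lem a b , Sigma-Omega-sameEntropy lem a b
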